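{- For any matroid $M$, the constant term of $Q_M(t)$ equals $(-1)^{\mathrm{rk}\,M}$ times the constant term of the characteristic polynomial $\chi_M(t)$.
   Context: For a matroid $M$ on ground set $E$, $L(M)$ is its lattice of flats with minimal element $\hat 0=\mathrm{cl}(\emptyset)$ and maximal element $E$. For a flat $F$, $M_F$ is the restriction of $M$ to $F$ (rank $\mathrm{rk}\,F$, lattice of flats isomorphic to $[\hat 0,F]$) and $M^F$ is the contraction $M/F$ (rank $\mathrm{rk}\,M-\mathrm{rk}\,F$, lattice of flats isomorphic to $[F,E]$). The characteristic polynomial is $\chi_M(t)=\sum_{F\in L(M)}\mu_{L(M)}(\hat 0,F)\,t^{\mathrm{rk}\,M-\mathrm{rk}\,F}$. The inverse Kazhdan–Lusztig polynomial $Q_M(t)\in\mathbb{Z}[t]$ is the unique assignment to each matroid such that $Q_M=1$ if $\mathrm{rk}\,M=0$, $\deg Q_M<\frac12\mathrm{rk}\,M$ if $\mathrm{rk}\,M>0$, and $t^{\mathrm{rk}\,M}(-1)^{\mathrm{rk}\,M}Q_M(t^{ -1})=\sum_{F\in L(M)}(-1)^{\mathrm{rk}\,M_F}Q_{M_F}(t)\,t^{\mathrm{rk}\,M^F}\chi_{M^F}(t^{ -1})$ for every $M$. -}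

module Defs where

open import Data.Nat as ℕ using (ℕ; zero; suc; _≤_; _<_; _∸_; _≡ᵇ_)
open import Data.Integer as ℤ using (ℤ; 0ℤ; 1ℤ; -1ℤ; _+_; _*_; -_)
open import Data.Bool using (Bool; true; false; if_then_else_; _∧_; _∨_; not)
open import Data.List as List using (List; []; _∷_; _++_; filter; allFin)
open import Data.Vec using (Vec; []; _∷_)
open import Data.Vec.Properties using (≡-dec)
import Data.Bool.Properties as BoolP
open import Data.Fin using (Fin)
open import Data.Fin.Subset using (Subset; _∈_; _⊆_; _∪_; _∩_; ⊤; ⊥; ⁅_⁆; ∣_∣)
open import Data.Fin.Subset.Properties using (_∈?_; _⊆?_)
open import Data.Product using (_×_)
open import Relation.Nullary using (¬_; Dec; yes; no)
open import Relation.Nullary.Decidable using (⌊_⌋)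
open import Relation.Binary.PropositionalEquality using (_≡_)

RankFn : ℕ → Set
RankFn n = Subset n → ℕ

record IsMatroid {n : ℕ} (rk : RankFn n) : Set where
  field
    rk-bound  : ∀ A → rk A ≤ ∣ A ∣
    rk-mono   : ∀ A B → A ⊆ B → rk A ≤ rk B
    rk-submod : ∀ A B → rk (A ∪ B) ℕ.+ rk (A ∩ B) ≤ rk A ℕ.+ rk B

rank : ∀ {n} → RankFn n → ℕ
rank rk = rk ⊤

subsets : (n : ℕ) → List (Subset n)
subsets zero    = [] ∷ []
subsets (suc n) = List.map (true ∷_) (subsets n) ++ List.map (false ∷_) (subsets n)

_≟S_ : ∀ {n} (A B : Subset n) → Dec (A ≡ B)
_≟S_ = ≡-dec BoolP._≟_

cl : ∀ {n} → RankFn n → Subset n → Subset n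
cl {n} rk A = Data.Vec.tabulate (λ x → rk (A ∪ ⁅ x ⁆) ≡ᵇ rk A)
  where import Data.Vec

isFlat : ∀ {n} → RankFn n → Subset n → Bool
isFlat {n} rk A =
  List.foldr (λ x b → (⌊ x ∈? A ⌋ ∨ not (rk (A ∪ ⁅ x ⁆) ≡ᵇ rk A)) ∧ b) true (allFin n)

flats : ∀ {n} → RankFn n → List (Subset n)
flats {n} rk = filter (λ A → Data.Bool.T? (isFlat rk A)) (subsets n)
  where import Data.Bool

bot : ∀ {n} → RankFn n → Subset n
bot rk = cl rk ⊥

-- The recursion is on a fuel argument; fuel n+1 suffices since every
-- strict chain of subsets of Fin n has length ≤ n.

sumℤ : List ℤ → ℤ
sumℤ = List.foldr _+_ 0ℤ

möbius-fuel : ∀ {n} → ℕ → List (Subset n) → Subset n → Subset n → ℤ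
möbius-fuel zero    L F G = 0ℤ
möbius-fuel (suc k) L F G with G ≟S F
... | yes _ = 1ℤ
... | no  _ with F ⊆? G
...   | no  _ = 0ℤ
...   | yes _ = - sumℤ (List.map (möbius-fuel k L F)
                  (filter (λ H → Data.Bool.T? (⌊ F ⊆? H ⌋ ∧ ⌊ H ⊆? G ⌋ ∧ not ⌊ H ≟S G ⌋)) L))
  where import Data.Bool

μ : ∀ {n} → RankFn n → Subset n → Subset n → ℤ
μ {n} rk = möbius-fuel (suc n) (flats rk)

-- Polynomials in ℤ[t], represented by their coefficient sequences ℕ → ℤ
-- (coefficient of t^k at k). Equality is pointwise.

Poly : Set
Poly = ℕ → ℤ

_≈P_ : Poly → Poly → Set
p ≈P q = ∀ k → p k ≡ q k

oneP : Poly
oneP zero    = 1ℤ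
oneP (suc _) = 0ℤ

monoP : ℤ → ℕ → Poly
monoP c d k = if d ≡ᵇ k then c else 0ℤ

_·P_ : ℤ → Poly → Poly
(c ·P p) k = c * p k

sumP : List Poly → Poly
sumP ps k = sumℤ (List.map (λ p → p k) ps)

_*P_ : Poly → Poly → Poly
(p *P q) k = sumℤ (List.map (λ i → p i * q (k ∸ i)) (List.upTo (suc k)))

-- t^d · p(t⁻¹), for a polynomial p of degree ≤ d
revP : ℕ → Poly → Poly
revP d p k = if k ℕ.≤ᵇ d then p (d ∸ k) else 0ℤ

degBelowHalf : Poly → ℕ → Set
degBelowHalf p r = ∀ k → r ≤ 2 ℕ.* k → p k ≡ 0ℤ

χ : ∀ {n} → RankFn n → Poly
χ rk = sumP (List.map (λ F → monoP (μ rk (bot rk) F) (rank rk ∸ rk F)) (flats rk))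

-- Restriction and contraction to a flat F, as matroids on the same
-- ground set Fin n (elements outside the new ground set become loops;
-- this does not change the lattice of flats up to isomorphism, nor the rank).

-- M_F : rank function A ↦ rk (A ∩ F)      (lattice of flats ≅ [0̂, F])
restrict : ∀ {n} → RankFn n → Subset n → RankFn n
restrict rk F A = rk (A ∩ F)

-- M^F = M / F : rank function A ↦ rk (A ∪ F) - rk F   (lattice ≅ [F, E])
contract : ∀ {n} → RankFn n → Subset n → RankFn n
contract rk F A = rk (A ∪ F) ∸ rk F

Assignment : Set
Assignment = ∀ {n} → RankFn n → Poly

sgn : ℕ → ℤ
sgn k = -1ℤ ℤ.^ k

klRHS : Assignment → ∀ {n} → RankFn n → Poly
klRHS Q rk = sumP (List.map term (flats rk))
  where
    term : _ → Poly
    term F = sgn (rank (restrict rk F)) ·P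
             (Q (restrict rk F) *P revP (rank (contract rk F)) (χ (contract rk F)))

record IsInverseKL (Q : Assignment) : Set where
  field
    rank-zero : ∀ {n} (rk : RankFn n) → IsMatroid rk → rank rk ≡ 0 → Q rk ≈P oneP
    degree    : ∀ {n} (rk : RankFn n) → IsMatroid rk → 0 < rank rk →
                degBelowHalf (Q rk) (rank rk)
    equation  : ∀ {n} (rk : RankFn n) → IsMatroid rk →
                (sgn (rank rk) ·P revP (rank rk) (Q rk)) ≈P klRHS Q rk

-- Read off the coefficient of t^(rk M) in the defining identity of Q_M. On the left it is
-- (-1)^(rk M) Q_M(0). On the right, the summand of a flat F of positive rank contributes
-- nothing to this coefficient: deg Q_{M_F} < rk F / 2 ≤ rk F, while t^(rk M^F) χ_{M^F}(t⁻¹)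
-- has degree rk M - rk F. Only the flat 0̂ of loops has rank zero; there Q_{M_0̂} = 1 and
-- M / 0̂ has the rank function of M, so its summand contributes exactly χ_M(0).
module Submission where

open import Defs
open import Data.Integer using (_*_)
open import Relation.Binary.PropositionalEquality using (_≡_)

open import Data.Bool using (Bool; true; false; if_then_else_; _∧_; _∨_; not; T; T?)
open import Data.Bool.Properties using (T-≡; T-∨; T-not-≡)
open import Data.Fin using (Fin)
open import Data.Fin.Subset using (Subset; _∈_; _⊆_; _∪_; _∩_; ⊤; ⊥; ⁅_⁆; ⋃)
open import Data.Fin.Subset.Properties
  using ( _∈?_; ∈⊤; x∈⁅x⁆; x∈⁅y⁆⇒x≡y; ⊆-antisym; ∣⊥∣≡0; p⊆p∪q; q⊆p∪q; x∈p∪q⁺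
        ; x∈p∩q⁺; x∈p∩q⁻; p∩q⊆p; ∩-identityˡ; ∪-identityˡ; ∪-zeroˡ; ∩-distribʳ-∪)
open import Data.Integer as ℤ using (ℤ; 0ℤ; 1ℤ; -1ℤ; _+_)
open import Data.Integer.Properties
  using (+-identityˡ; +-identityʳ; +-assoc; *-identityˡ; *-zeroˡ; *-zeroʳ; *-assoc; ^-zeroˡ; ^-distribˡ-+-*; ^-*-assoc)
open import Data.Bool.ListAction using (all)
open import Data.List as List using (List; []; _∷_; _++_; map; filter; allFin; applyUpTo)
open import Data.List.Membership.Propositional.Properties using (∈-allFin; ∈-filter⁺; ∈-map⁺)
import Data.List.Membership.Propositional as List
open import Data.List.Properties using (map-∘; map-cong; foldr-cong; foldr-map)
open import Data.List.Relation.Unary.All as All using (All; []; _∷_)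
open import Data.List.Relation.Unary.All.Properties using (all⁺; all⁻; all-filter; applyUpTo⁺₂; map⁺)
open import Data.List.Relation.Unary.Any using (here; there)
open import Data.Nat as ℕ using (ℕ; zero; suc; _≤_; _<_; _∸_; _≡ᵇ_; _≤ᵇ_)
open import Data.Nat.Properties
  using ( ≤-refl; ≤-trans; ≤-reflexive; ≤-antisym; ≤-<-trans; <⇒≱; ≰⇒>; m≤m+n; +-mono-≤
        ; n≤0⇒n≡0; n≢0⇒n>0; n∸n≡0; ∸-monoʳ-<; ≡ᵇ⇒≡; ≡⇒≡ᵇ; ≤ᵇ-reflects-≤; _≤?_)
import Data.Nat.Properties as ℕ
open import Data.Product using (_,_)
open import Data.Sum using (inj₁; inj₂)
open import Data.Unit using (tt)
open import Data.Vec using ([]; _∷_; head; tail)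
open import Data.Vec.Properties using (lookup∘tabulate; lookup⇒[]=; []=⇒lookup; tabulate-cong)
open import Function using (_∘_; Equivalence)
open import Relation.Binary.PropositionalEquality using (refl; sym; trans; cong; cong₂; subst; _≢_; _≗_; module ≡-Reasoning)
open import Relation.Nullary using (yes; no; ofʸ; ofⁿ; contradiction)
open import Relation.Nullary.Decidable using (⌊_⌋; toWitness)

open ≡-Reasoning

T⇒≡true : ∀ {b} → T b → b ≡ true
T⇒≡true = Equivalence.to T-≡

≡true⇒T : ∀ {b} → b ≡ true → T b
≡true⇒T = Equivalence.from T-≡

module _ {A : Set} where

  sumℤ-++ : (f : A → ℤ) (xs ys : List A) →
            sumℤ (map f (xs ++ ys)) ≡ sumℤ (map f xs) + sumℤ (map f ys)
  sumℤ-++ f []       ys = sym (+-identityˡ _)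
  sumℤ-++ f (x ∷ xs) ys = trans (cong (f x +_) (sumℤ-++ f xs ys)) (sym (+-assoc (f x) _ _))

  sumℤ-zero : {f : A → ℤ} {xs : List A} → All (λ x → f x ≡ 0ℤ) xs → sumℤ (map f xs) ≡ 0ℤ
  sumℤ-zero []         = refl
  sumℤ-zero (fx≡0 ∷ h) rewrite fx≡0 | sumℤ-zero h = refl

  sumℤ-filter : (p : A → Bool) (f : A → ℤ) (xs : List A) →
                sumℤ (map f (filter (T? ∘ p) xs)) ≡ sumℤ (map (λ x → if p x then f x else 0ℤ) xs)
  sumℤ-filter p f []       = refl
  sumℤ-filter p f (x ∷ xs) with p x
  ... | true  = cong (f x +_) (sumℤ-filter p f xs)
  ... | false = trans (sumℤ-filter p f xs) (sym (+-identityˡ _))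

  filter-T?-cong : {p q : A → Bool} → p ≗ q → filter (T? ∘ p) ≗ filter (T? ∘ q)
  filter-T?-cong p≗q []       = refl
  filter-T?-cong {p} {q} p≗q (x ∷ xs) with p x | q x | p≗q x
  ... | true  | true  | refl = cong (x ∷_) (filter-T?-cong p≗q xs)
  ... | false | false | refl = filter-T?-cong p≗q xs

sumℤ-subsets-suc : ∀ {n} (f : Subset (suc n) → ℤ) →
                   sumℤ (map f (subsets (suc n)))
                   ≡ sumℤ (map (f ∘ (true ∷_)) (subsets n)) + sumℤ (map (f ∘ (false ∷_)) (subsets n))
sumℤ-subsets-suc {n} f = begin
  sumℤ (map f (map (true ∷_) (subsets n) ++ map (false ∷_) (subsets n)))
    ≡⟨ sumℤ-++ f (map (true ∷_) (subsets n)) (map (false ∷_) (subsets n)) ⟩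
  sumℤ (map f (map (true ∷_) (subsets n))) + sumℤ (map f (map (false ∷_) (subsets n)))
    ≡⟨ sym (cong₂ _+_ (cong sumℤ (map-∘ (subsets n))) (cong sumℤ (map-∘ (subsets n)))) ⟩
  sumℤ (map (f ∘ (true ∷_)) (subsets n)) + sumℤ (map (f ∘ (false ∷_)) (subsets n)) ∎

sumℤ-subsets-single : ∀ {n} (f : Subset n → ℤ) (S : Subset n) →
                      (∀ S′ → S′ ≢ S → f S′ ≡ 0ℤ) → sumℤ (map f (subsets n)) ≡ f S
sumℤ-subsets-single {zero}  f []      _   = +-identityʳ (f [])
sumℤ-subsets-single {suc n} f (b ∷ S) off = trans (sumℤ-subsets-suc f) (slices b off)
  where
  onSlice : ∀ c → (∀ S′ → S′ ≢ c ∷ S → f S′ ≡ 0ℤ) → sumℤ (map (f ∘ (c ∷_)) (subsets n)) ≡ f (c ∷ S)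
  onSlice c off = sumℤ-subsets-single (f ∘ (c ∷_)) S (λ S′ S′≢S → off (c ∷ S′) (S′≢S ∘ cong tail))

  offSlice : ∀ c c′ → c′ ≢ c → (∀ S′ → S′ ≢ c ∷ S → f S′ ≡ 0ℤ) → sumℤ (map (f ∘ (c′ ∷_)) (subsets n)) ≡ 0ℤ
  offSlice c c′ c′≢c off = sumℤ-zero (All.universal (λ S′ → off (c′ ∷ S′) (c′≢c ∘ cong head)) (subsets n))

  slices : ∀ c → (∀ S′ → S′ ≢ c ∷ S → f S′ ≡ 0ℤ) →
           sumℤ (map (f ∘ (true ∷_)) (subsets n)) + sumℤ (map (f ∘ (false ∷_)) (subsets n)) ≡ f (c ∷ S)
  slices true  off = trans (cong₂ _+_ (onSlice true off) (offSlice true false (λ ()) off)) (+-identityʳ _)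
  slices false off = trans (cong₂ _+_ (offSlice false true (λ ()) off) (onSlice false off)) (+-identityˡ _)

sgn-*-sgn : ∀ r → sgn r * sgn r ≡ 1ℤ
sgn-*-sgn r = begin
  sgn r * sgn r           ≡⟨ cong (λ m → sgn r * sgn m) (sym (ℕ.+-identityʳ r)) ⟩
  sgn r * sgn (r ℕ.+ 0)   ≡⟨ sym (^-distribˡ-+-* -1ℤ r (r ℕ.+ 0)) ⟩
  -1ℤ ℤ.^ (2 ℕ.* r)       ≡⟨ sym (^-*-assoc -1ℤ 2 r) ⟩
  1ℤ ℤ.^ r                ≡⟨ ^-zeroˡ r ⟩
  1ℤ                      ∎

revP-top : ∀ d p → revP d p d ≡ p 0
revP-top d p with d ≤ᵇ d | ≤ᵇ-reflects-≤ d d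
... | true  | _        = cong p (n∸n≡0 d)
... | false | ofⁿ d≰d = contradiction ≤-refl d≰d

revP-above : ∀ {d k} p → d < k → revP d p k ≡ 0ℤ
revP-above {d} {k} p d<k with k ≤ᵇ d | ≤ᵇ-reflects-≤ k d
... | true  | ofʸ k≤d = contradiction k≤d (<⇒≱ d<k)
... | false | _        = refl

*P-identityˡ : ∀ {p} → p ≈P oneP → ∀ q → (p *P q) ≈P q
*P-identityˡ {p} p≈1 q k = begin
  p 0 * q k + sumℤ (map (λ i → p i * q (k ∸ i)) (applyUpTo suc k))
    ≡⟨ cong₂ _+_ (cong (_* q k) (p≈1 0)) (sumℤ-zero (applyUpTo⁺₂ suc k pos-coeff)) ⟩
  1ℤ * q k + 0ℤ   ≡⟨ +-identityʳ _ ⟩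
  1ℤ * q k        ≡⟨ *-identityˡ _ ⟩
  q k             ∎
  where
  pos-coeff : ∀ j → p (suc j) * q (k ∸ suc j) ≡ 0ℤ
  pos-coeff j = trans (cong (_* q (k ∸ suc j)) (p≈1 (suc j))) (*-zeroˡ (q (k ∸ suc j)))

-- For i < s the reversed factor is read above its degree r ∸ s; for 2i ≥ s, p i vanishes.
*P-revP-top-vanishes : ∀ {p s r} → degBelowHalf p s → s ≤ r → ∀ q → (p *P revP (r ∸ s) q) r ≡ 0ℤ
*P-revP-top-vanishes {p} {s} {r} deg s≤r q = sumℤ-zero (applyUpTo⁺₂ (λ i → i) (suc r) vanishes)
  where
  vanishes : ∀ i → p i * revP (r ∸ s) q (r ∸ i) ≡ 0ℤ
  vanishes i with s ≤? 2 ℕ.* i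
  ... | yes s≤2i = trans (cong (_* revP (r ∸ s) q (r ∸ i)) (deg i s≤2i)) (*-zeroˡ (revP (r ∸ s) q (r ∸ i)))
  ... | no  s≰2i = trans (cong (p i *_) (revP-above q (∸-monoʳ-< i<s s≤r))) (*-zeroʳ (p i))
    where
    i<s : i < s
    i<s = ≤-<-trans (m≤m+n i (i ℕ.+ 0)) (≰⇒> s≰2i)

module _ {n : ℕ} (rk : RankFn n) where

  rank-restrict : ∀ F → rank (restrict rk F) ≡ rk F
  rank-restrict F = cong rk (∩-identityˡ F)

  rank-contract : ∀ F → rank (contract rk F) ≡ rank rk ∸ rk F
  rank-contract F = cong (λ A → rk A ∸ rk F) (∪-zeroˡ F)

  ∈-cl⁺ : ∀ {A x} → rk (A ∪ ⁅ x ⁆) ≡ rk A → x ∈ cl rk A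
  ∈-cl⁺ {x = x} e = lookup⇒[]= x _ (trans (lookup∘tabulate _ x) (T⇒≡true (≡⇒≡ᵇ _ _ e)))

  ∈-cl⁻ : ∀ {A x} → x ∈ cl rk A → rk (A ∪ ⁅ x ⁆) ≡ rk A
  ∈-cl⁻ {x = x} x∈ = ≡ᵇ⇒≡ _ _ (≡true⇒T (trans (sym (lookup∘tabulate _ x)) ([]=⇒lookup x∈)))

  isFlat-all : ∀ A → isFlat rk A ≡ all (λ x → ⌊ x ∈? A ⌋ ∨ not (rk (A ∪ ⁅ x ⁆) ≡ᵇ rk A)) (allFin n)
  isFlat-all A = sym (foldr-map _∧_ _ true (allFin n))

  isFlat⁺ : ∀ {A} → (∀ x → rk (A ∪ ⁅ x ⁆) ≡ rk A → x ∈ A) → T (isFlat rk A)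
  isFlat⁺ {A} closed = subst T (sym (isFlat-all A)) (all⁻ _ (All.universal outside-raises (allFin n)))
    where
    outside-raises : ∀ x → T (⌊ x ∈? A ⌋ ∨ not (rk (A ∪ ⁅ x ⁆) ≡ᵇ rk A))
    outside-raises x with x ∈? A
    ... | yes _   = tt
    ... | no  x∉A with rk (A ∪ ⁅ x ⁆) ≡ᵇ rk A in eq
    ...   | true  = contradiction (closed x (≡ᵇ⇒≡ _ _ (≡true⇒T eq))) x∉A
    ...   | false = tt

  isFlat⁻ : ∀ {A x} → T (isFlat rk A) → rk (A ∪ ⁅ x ⁆) ≡ rk A → x ∈ A
  isFlat⁻ {A} {x} flat e
    with Equivalence.to T-∨ (All.lookup (all⁺ _ (allFin n) (subst T (isFlat-all A) flat)) (∈-allFin x))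
  ... | inj₁ x∈A     = toWitness x∈A
  ... | inj₂ raises = contradiction (≡⇒≡ᵇ _ _ e) (subst T (Equivalence.to T-not-≡ raises))

  sumℤ-flats-single : (f : Subset n → ℤ) {F₀ : Subset n} → T (isFlat rk F₀) →
                      (∀ F → T (isFlat rk F) → F ≢ F₀ → f F ≡ 0ℤ) → sumℤ (map f (flats rk)) ≡ f F₀
  sumℤ-flats-single f {F₀} F₀-flat off = begin
    sumℤ (map f (flats rk))            ≡⟨ sumℤ-filter (isFlat rk) f (subsets n) ⟩
    sumℤ (map onFlats (subsets n))     ≡⟨ sumℤ-subsets-single onFlats F₀ offF₀ ⟩
    onFlats F₀                         ≡⟨ atF₀ ⟩
    f F₀                               ∎
    where
    onFlats : Subset n → ℤ
    onFlats F = if isFlat rk F then f F else 0ℤ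

    offF₀ : ∀ F → F ≢ F₀ → onFlats F ≡ 0ℤ
    offF₀ F F≢F₀ with isFlat rk F in flat
    ... | true  = off F (≡true⇒T flat) F≢F₀
    ... | false = refl

    atF₀ : onFlats F₀ ≡ f F₀
    atF₀ rewrite T⇒≡true F₀-flat = refl

module _ {n : ℕ} {rk rk′ : RankFn n} (rk≗rk′ : rk ≗ rk′) where

  flats-cong : flats rk ≡ flats rk′
  flats-cong = filter-T?-cong isFlat-cong (subsets n)
    where
    isFlat-cong : isFlat rk ≗ isFlat rk′
    isFlat-cong A = foldr-cong (λ x b → cong₂ (λ r r′ → (⌊ x ∈? A ⌋ ∨ not (r ≡ᵇ r′)) ∧ b) (rk≗rk′ _) (rk≗rk′ A))
                               refl (allFin n)

  bot-cong : bot rk ≡ bot rk′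
  bot-cong = tabulate-cong (λ x → cong₂ _≡ᵇ_ (rk≗rk′ _) (rk≗rk′ ⊥))

  χ-cong : χ rk ≈P χ rk′
  χ-cong k = begin
    χ rk k
      ≡⟨ cong sumℤ (sym (map-∘ (flats rk))) ⟩
    sumℤ (map (λ F → monoP (μ rk (bot rk) F) (rank rk ∸ rk F) k) (flats rk))
      ≡⟨ cong₂ (λ L b → sumℤ (map (λ F → monoP (möbius-fuel (suc n) L b F) (rank rk ∸ rk F) k) L))
               flats-cong bot-cong ⟩
    sumℤ (map (λ F → monoP (μ rk′ (bot rk′) F) (rank rk ∸ rk F) k) (flats rk′))
      ≡⟨ cong sumℤ (map-cong (λ F → cong₂ (λ r r′ → monoP (μ rk′ (bot rk′) F) (r ∸ r′) k)
                                          (rk≗rk′ ⊤) (rk≗rk′ F)) (flats rk′)) ⟩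
    sumℤ (map (λ F → monoP (μ rk′ (bot rk′) F) (rank rk′ ∸ rk′ F) k) (flats rk′))
      ≡⟨ cong sumℤ (map-∘ (flats rk′)) ⟩
    χ rk′ k
      ∎

∈-⋃⁺ : ∀ {n} {x : Fin n} {B : Subset n} {Bs : List (Subset n)} → x ∈ B → B List.∈ Bs → x ∈ ⋃ Bs
∈-⋃⁺ x∈B (here refl)  = x∈p∪q⁺ (inj₁ x∈B)
∈-⋃⁺ x∈B (there B∈Bs) = x∈p∪q⁺ (inj₂ (∈-⋃⁺ x∈B B∈Bs))

⊆-⋃-singletons : ∀ {n} (A : Subset n) → A ⊆ ⋃ (map ⁅_⁆ (filter (_∈? A) (allFin n)))
⊆-⋃-singletons A {x} x∈A = ∈-⋃⁺ (x∈⁅x⁆ x) (∈-map⁺ ⁅_⁆ (∈-filter⁺ (_∈? A) (∈-allFin x) x∈A))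

module _ {n : ℕ} {rk : RankFn n} (M : IsMatroid rk) where
  open IsMatroid M

  rk-∅ : rk ⊥ ≡ 0
  rk-∅ = n≤0⇒n≡0 (≤-trans (rk-bound ⊥) (≤-reflexive (∣⊥∣≡0 n)))

  rk≤rank : ∀ A → rk A ≤ rank rk
  rk≤rank A = rk-mono A ⊤ (λ _ → ∈⊤)

  rk-∪-null : ∀ {N} → rk N ≡ 0 → ∀ A → rk (A ∪ N) ≡ rk A
  rk-∪-null {N} rkN≡0 A = ≤-antisym
    (≤-trans (m≤m+n _ (rk (A ∩ N)))
      (≤-trans (rk-submod A N) (≤-reflexive (trans (cong (rk A ℕ.+_) rkN≡0) (ℕ.+-identityʳ (rk A))))))
    (rk-mono A (A ∪ N) (p⊆p∪q N))

  rk-⋃-null : ∀ {Bs} → All (λ B → rk B ≡ 0) Bs → rk (⋃ Bs) ≡ 0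
  rk-⋃-null []                  = rk-∅
  rk-⋃-null {B ∷ _} (rkB≡0 ∷ h) = trans (rk-∪-null (rk-⋃-null h) B) rkB≡0

  rk-loops : ∀ {A} → (∀ {x} → x ∈ A → rk ⁅ x ⁆ ≡ 0) → rk A ≡ 0
  rk-loops {A} loop = n≤0⇒n≡0 (≤-trans (rk-mono _ _ (⊆-⋃-singletons A))
    (≤-reflexive (rk-⋃-null (map⁺ (All.map loop (all-filter (_∈? A) (allFin n)))))))

  restrict-isMatroid : ∀ F → IsMatroid (restrict rk F)
  restrict-isMatroid F = record
    { rk-bound  = λ A → ≤-trans (rk-mono _ _ (p∩q⊆p A F)) (rk-bound A)
    ; rk-mono   = λ A B A⊆B → rk-mono _ _ (∩-monoˡ A⊆B)
    ; rk-submod = λ A B → ≤-trans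
        (≤-reflexive (cong (λ C → rk C ℕ.+ rk ((A ∩ B) ∩ F)) (∩-distribʳ-∪ F A B)))
        (≤-trans (+-mono-≤ ≤-refl (rk-mono _ _ (∩-⊆-∩∩ A B))) (rk-submod (A ∩ F) (B ∩ F)))
    }
    where
    ∩-monoˡ : ∀ {A B} → A ⊆ B → A ∩ F ⊆ B ∩ F
    ∩-monoˡ {A} A⊆B x∈ with x∈p∩q⁻ A F x∈
    ... | x∈A , x∈F = x∈p∩q⁺ (A⊆B x∈A , x∈F)
    ∩-⊆-∩∩ : ∀ A B → (A ∩ B) ∩ F ⊆ (A ∩ F) ∩ (B ∩ F)
    ∩-⊆-∩∩ A B x∈ with x∈p∩q⁻ (A ∩ B) F x∈
    ... | x∈A∩B , x∈F with x∈p∩q⁻ A B x∈A∩B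
    ...   | x∈A , x∈B = x∈p∩q⁺ (x∈p∩q⁺ (x∈A , x∈F) , x∈p∩q⁺ (x∈B , x∈F))

  contract-null : ∀ {N} → rk N ≡ 0 → contract rk N ≗ rk
  contract-null rkN≡0 A rewrite rkN≡0 = rk-∪-null rkN≡0 A

  ∈-bot⁺ : ∀ {x} → rk ⁅ x ⁆ ≡ 0 → x ∈ bot rk
  ∈-bot⁺ {x} loop = ∈-cl⁺ rk (trans (cong rk (∪-identityˡ ⁅ x ⁆)) (trans loop (sym rk-∅)))

  ∈-bot⁻ : ∀ {x} → x ∈ bot rk → rk ⁅ x ⁆ ≡ 0
  ∈-bot⁻ {x} x∈ = trans (sym (cong rk (∪-identityˡ ⁅ x ⁆))) (trans (∈-cl⁻ rk x∈) rk-∅)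

  rk-bot : rk (bot rk) ≡ 0
  rk-bot = rk-loops ∈-bot⁻

  bot-isFlat : T (isFlat rk (bot rk))
  bot-isFlat = isFlat⁺ rk λ x same → ∈-bot⁺ (n≤0⇒n≡0 (≤-trans (rk-mono _ _ (q⊆p∪q (bot rk) ⁅ x ⁆))
                                                      (≤-reflexive (trans same rk-bot))))

  null-flat≡bot : ∀ {F} → T (isFlat rk F) → rk F ≡ 0 → F ≡ bot rk
  null-flat≡bot {F} flat rkF≡0 = ⊆-antisym F⊆bot bot⊆F
    where
    F⊆bot : F ⊆ bot rk
    F⊆bot {x} x∈F = ∈-bot⁺ (n≤0⇒n≡0 (≤-trans (rk-mono _ _ (λ y∈ → subst (_∈ F) (sym (x∈⁅y⁆⇒x≡y x y∈)) x∈F))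
                                              (≤-reflexive rkF≡0)))
    bot⊆F : bot rk ⊆ F
    bot⊆F x∈ = isFlat⁻ rk flat (rk-∪-null (∈-bot⁻ x∈) F)

module _ (Q : Assignment) (isInverseKL : IsInverseKL Q) {n : ℕ} {rk : RankFn n} (M : IsMatroid rk) where
  open IsInverseKL isInverseKL

  -- The summand of klRHS: klRHS Q rk is sumP (map klTerm (flats rk)) definitionally.
  klTerm : Subset n → Poly
  klTerm F = sgn (rank (restrict rk F)) ·P
             (Q (restrict rk F) *P revP (rank (contract rk F)) (χ (contract rk F)))

  klTerm-top-bot : klTerm (bot rk) (rank rk) ≡ χ rk 0
  klTerm-top-bot = begin
    sgn (rank M_bot) * (Q M_bot *P revP (rank M^bot) (χ M^bot)) r
      ≡⟨ cong₂ _*_ (cong sgn rank-M_bot) (*P-identityˡ Q-M_bot≈1 (revP (rank M^bot) (χ M^bot)) r) ⟩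
    1ℤ * revP (rank M^bot) (χ M^bot) r   ≡⟨ *-identityˡ _ ⟩
    revP (rank M^bot) (χ M^bot) r        ≡⟨ cong (λ d → revP d (χ M^bot) r) rank-M^bot ⟩
    revP r (χ M^bot) r                ≡⟨ revP-top r (χ M^bot) ⟩
    χ M^bot 0                         ≡⟨ χ-cong (contract-null M (rk-bot M)) 0 ⟩
    χ rk 0                         ∎
    where
    r = rank rk
    M_bot = restrict rk (bot rk)
    M^bot = contract rk (bot rk)
    rank-M_bot : rank M_bot ≡ 0
    rank-M_bot = trans (rank-restrict rk (bot rk)) (rk-bot M)
    Q-M_bot≈1 : Q M_bot ≈P oneP
    Q-M_bot≈1 = rank-zero M_bot (restrict-isMatroid M (bot rk)) rank-M_bot
    rank-M^bot : rank M^bot ≡ r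
    rank-M^bot = trans (rank-contract rk (bot rk)) (cong (r ∸_) (rk-bot M))

  klTerm-top-vanishes : ∀ {F} → 0 < rk F → klTerm F (rank rk) ≡ 0ℤ
  klTerm-top-vanishes {F} 0<rkF = begin
    sgn (rank M_F) * (Q M_F *P revP (rank M^F) (χ M^F)) r
      ≡⟨ cong (λ d → sgn (rank M_F) * (Q M_F *P revP d (χ M^F)) r) (rank-contract rk F) ⟩
    sgn (rank M_F) * (Q M_F *P revP (r ∸ rk F) (χ M^F)) r
      ≡⟨ cong (sgn (rank M_F) *_) (*P-revP-top-vanishes deg (rk≤rank M F) (χ M^F)) ⟩
    sgn (rank M_F) * 0ℤ   ≡⟨ *-zeroʳ (sgn (rank M_F)) ⟩
    0ℤ                    ∎
    where
    r = rank rk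
    M_F = restrict rk F
    M^F = contract rk F
    deg : degBelowHalf (Q M_F) (rk F)
    deg = subst (degBelowHalf (Q M_F)) (rank-restrict rk F)
            (degree M_F (restrict-isMatroid M F) (subst (0 <_) (sym (rank-restrict rk F)) 0<rkF))

  klRHS-top : klRHS Q rk (rank rk) ≡ χ rk 0
  klRHS-top = begin
    klRHS Q rk (rank rk)                           ≡⟨ cong sumℤ (sym (map-∘ (flats rk))) ⟩
    sumℤ (map (λ F → klTerm F (rank rk)) (flats rk)) ≡⟨ sumℤ-flats-single rk _ (bot-isFlat M) off-bot ⟩
    klTerm (bot rk) (rank rk)                      ≡⟨ klTerm-top-bot ⟩
    χ rk 0                                         ∎
    where
    off-bot : ∀ F → T (isFlat rk F) → F ≢ bot rk → klTerm F (rank rk) ≡ 0ℤ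
    off-bot F flat F≢bot = klTerm-top-vanishes (n≢0⇒n>0 (F≢bot ∘ null-flat≡bot M flat))

  sgn-rank-*-Q-constant : sgn (rank rk) * Q rk 0 ≡ χ rk 0
  sgn-rank-*-Q-constant = begin
    sgn (rank rk) * Q rk 0                  ≡⟨ cong (sgn (rank rk) *_) (sym (revP-top (rank rk) (Q rk))) ⟩
    sgn (rank rk) * revP (rank rk) (Q rk) (rank rk) ≡⟨ equation rk M (rank rk) ⟩
    klRHS Q rk (rank rk)                    ≡⟨ klRHS-top ⟩
    χ rk 0                                  ∎

proposition2p2 : (Q : Assignment) → IsInverseKL Q →
                 ∀ {n} (rk : RankFn n) → IsMatroid rk →
                 Q rk 0 ≡ sgn (rank rk) * χ rk 0
proposition2p2 Q isInverseKL rk M = begin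
  Q rk 0                        ≡⟨ sym (*-identityˡ (Q rk 0)) ⟩
  1ℤ * Q rk 0                   ≡⟨ cong (_* Q rk 0) (sym (sgn-*-sgn r)) ⟩
  (sgn r * sgn r) * Q rk 0      ≡⟨ *-assoc (sgn r) (sgn r) (Q rk 0) ⟩
  sgn r * (sgn r * Q rk 0)      ≡⟨ cong (sgn r *_) (sgn-rank-*-Q-constant Q isInverseKL M) ⟩
  sgn r * χ rk 0                ∎
  where
  r = rank rk
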